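{- Let $n \geq 3$ and let $S = S^1_{n^2}$ be the sunlet on $2n^2$ vertices. Then there is a homomorphism $\varphi: S \to C_n \,\Box\, C_n$ which is a covering and is 2-to-1 on vertices, such that $\varphi(Z(S))$ is a Hamiltonian cycle of $C_n \,\Box\, C_n$. Furthermore, $\varphi$ is compatible with the FSM orientation of $S$ and the standard orientation of $C_n \,\Box\, C_n$.
   Context: For $p \geq 3$, the sunlet $S^1_p$ is the graph obtained from a cycle $C_p$ by attaching one pendant edge at each vertex of the cycle (so it has $2p$ vertices: $p$ cycle vertices of degree 3 and $p$ vertices of degree 1, and $2p$ edges). $Z(S)$ denotes the unique cycle of a sunlet $S$. $C_n \,\Box\, C_n$ is the Cartesian product of two $n$-cycles (toroidal grid), with vertex set $\mathbb{Z}_n \times \mathbb{Z}_n$, where $(x,y)$ is adjacent to $(x\pm1,y)$ and $(x,y\pm1)$. A homomorphism $\varphi: G \to H$ is a map $V(G)\to V(H)$ sending edges $uw$ to edges $\varphi(u)\varphi(w)$; it is a covering if the induced map $E(G) \to E(H)$ is a bijection; it is 2-to-1 on vertices if every vertex of $H$ has exactly two preimages. The FSM orientation of a sunlet orients its cycle as a directed cycle and orients each pendant edge from its degree-1 vertex toward the cycle vertex (so every vertex has out-degree 1). The standard orientation of $C_n \,\Box\, C_n$ directs every edge in the direction of increasing coordinate, i.e. $(x,y) \to (x+1,y)$ and $(x,y) \to (x,y+1)$ (indices mod $n$). Given orientations of $G$ and $H$, $\varphi$ is compatible with them if $(\varphi(u),\varphi(w))$ is an arc of $H$ whenever $(u,w)$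 is an arc of $G$. -}

module Defs where

open import Data.Nat using (ℕ; zero; suc; _*_; _%_)
open import Data.Nat.DivMod using (m%n<n)
open import Data.Fin using (Fin; toℕ; fromℕ<)
open import Data.Product using (_×_; _,_; ∃; ∃-syntax)
open import Data.Sum using (_⊎_; inj₁; inj₂)
open import Relation.Binary.PropositionalEquality using (_≡_; _≢_)
open import Function.Definitions using (Bijective)

sucMod : ∀ {m} → Fin m → Fin m
sucMod {suc m} i = fromℕ< (m%n<n (suc (toℕ i)) (suc m))

-- Sunlet S^1_p : vertices inj₁ i (cycle vertex c_i), inj₂ i (pendant
-- vertex ℓ_i attached to c_i), i ∈ ℤ_p.

SunletV : ℕ → Set
SunletV p = Fin p ⊎ Fin p

data FSMArc {p : ℕ} : SunletV p → SunletV p → Set where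
  cyc  : (i : Fin p) → FSMArc (inj₁ i) (inj₁ (sucMod i))
  pend : (i : Fin p) → FSMArc (inj₂ i) (inj₁ i)

SunletAdj : ∀ {p} → SunletV p → SunletV p → Set
SunletAdj u w = FSMArc u w ⊎ FSMArc w u

cycleZ : ∀ {p} → Fin p → SunletV p
cycleZ i = inj₁ i

TorusV : ℕ → Set
TorusV n = Fin n × Fin n

data StdArc {n : ℕ} : TorusV n → TorusV n → Set where
  horiz : (x y : Fin n) → StdArc (x , y) (sucMod x , y)
  vert  : (x y : Fin n) → StdArc (x , y) (x , sucMod y)

TorusAdj : ∀ {n} → TorusV n → TorusV n → Set
TorusAdj u w = StdArc u w ⊎ StdArc w u

SameEdge : {V : Set} → V → V → V → V → Set
SameEdge a b c d = (a ≡ c × b ≡ d) ⊎ (a ≡ d × b ≡ c)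

IsHom : {V W : Set} → (V → V → Set) → (W → W → Set) → (V → W) → Set
IsHom {V} G H φ = ∀ (u w : V) → G u w → H (φ u) (φ w)

-- the induced map on (unordered) edges E(G) → E(H), {u,w} ↦ {φu,φw},
-- is a bijection
IsCovering : {V W : Set} → (V → V → Set) → (W → W → Set) → (V → W) → Set
IsCovering {V} {W} G H φ =
  IsHom G H φ
  × (∀ (u w u' w' : V) → G u w → G u' w' →
       SameEdge (φ u) (φ w) (φ u') (φ w') → SameEdge u w u' w')
  × (∀ (a b : W) → H a b →
       ∃[ u ] ∃[ w ] (G u w × SameEdge (φ u) (φ w) a b))

TwoToOne : {V W : Set} → (V → W) → Set
TwoToOne {V} {W} φ =
  ∀ (v : W) → ∃[ u₁ ] ∃[ u₂ ] (u₁ ≢ u₂ × φ u₁ ≡ v × φ u₂ ≡ v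
      × (∀ (u : V) → φ u ≡ v → u ≡ u₁ ⊎ u ≡ u₂))

-- the cyclic sequence f 0, f 1, …, f (p-1), f 0 is a Hamiltonian cycle of H:
-- it visits every vertex exactly once (f bijective onto V(H)) and
-- consecutive vertices (cyclically) are adjacent; p ≥ 3 is part of the
-- hypotheses where used.
IsHamiltonianCycle : {W : Set} {p : ℕ} → (W → W → Set) → (Fin p → W) → Set
IsHamiltonianCycle H f = Bijective _≡_ _≡_ f × (∀ i → H (f i) (f (sucMod i)))

Compatible : {V W : Set} → (V → V → Set) → (W → W → Set) → (V → W) → Set
Compatible {V} A B φ = ∀ (u w : V) → A u w → B (φ u) (φ w)

{-# OPTIONS --safe #-}

-- Every vertex of C_n □ C_n has in-degree and out-degree 2 in the standard orientation, and
-- for n ≥ 3 no two vertices are joined in both directions.  Walking the torus row by row,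
-- each row shifted one step back from the previous one, gives a directed Hamiltonian cycle
-- h.  Send c_k to h k and the pendant ℓ_k to the in-neighbour of h k other than h (k - 1).
-- Then every arc into h k is the image of exactly one FSM arc (the cycle arc or the pendant
-- arc at k), and every vertex v has exactly two preimages: c_k with h k = v, and ℓ_j where
-- h j is the out-neighbour of v off the cycle.

module Submission where

open import Defs
open import Data.Nat using (ℕ; _*_; _≥_)
open import Data.Product using (Σ; _×_)
open import Function using (_∘_)

open import Data.Empty using (⊥-elim)
open import Data.Fin using (Fin; toℕ; _≟_; combine)
open import Data.Fin.Properties using (toℕ-fromℕ<; fromℕ<-cong; toℕ-injective; toℕ<n; toℕ-combine)
open import Data.Nat using (suc; _+_; _<_; _>_; _/_; _%_; NonZero; >-nonZero; s≤s; z≤n)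
open import Data.Nat.DivMod
  using ( _mod_; m%n%n≡m%n; %-distribˡ-+; [m+n]%n≡m%n; [m+kn]%n≡m%n; m≡m%n+[m/n]*n; m<n⇒m%n≡m
        ; n%n≡0; m*n%n≡0; m%n<n; +-distrib-/; m<n⇒m/n≡0; m*n/n≡m; m<n*o⇒m/o<n)
open import Data.Nat.Divisibility using (divides; >⇒∤)
open import Data.Nat.Properties
  using ( +-comm; +-assoc; +-suc; +-identityʳ; +-cancelˡ-≡; *-comm; *-suc; *-zeroʳ
        ; suc-injective; <-trans; n<1+n; m≤n⇒m<n∨m≡n)
open import Data.Product using (_,_; proj₁; proj₂; ∃-syntax)
open import Data.Product.Properties using (≡-dec)
open import Data.Sum using (_⊎_; inj₁; inj₂)
open import Function using (_$_; flip)
open import Function.Consequences.Propositional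
  using (inverseᵇ⇒bijective; strictlyInverseˡ⇒inverseˡ; strictlyInverseʳ⇒inverseʳ)
open import Function.Definitions using (Injective; Bijective)
open import Relation.Binary.Definitions using (DecidableEquality; Asymmetric)
open import Relation.Binary.PropositionalEquality
open import Relation.Nullary using (yes; no; contradiction)
open ≡-Reasoning

private
  variable
    m : ℕ

[k+a%n]%n≡[k+a]%n : ∀ k a n .{{_ : NonZero n}} → (k + a % n) % n ≡ (k + a) % n
[k+a%n]%n≡[k+a]%n k a n = begin
  (k + a % n) % n         ≡⟨ %-distribˡ-+ k (a % n) n ⟩
  (k % n + a % n % n) % n ≡⟨ cong (λ r → (k % n + r) % n) (m%n%n≡m%n a n) ⟩
  (k % n + a % n) % n     ≡⟨ %-distribˡ-+ k a n ⟨
  (k + a) % n             ∎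

[d+a]%n≢a : ∀ {d a} n .{{_ : NonZero n}} → d > 0 → d < n → (d + a) % n ≢ a
[d+a]%n≢a {d} {a} n d>0 d<n [d+a]%n≡a = >⇒∤ {{>-nonZero d>0}} d<n (divides ((d + a) / n) d≡qn)
  where
    d≡qn : d ≡ (d + a) / n * n
    d≡qn = +-cancelˡ-≡ a _ _ (begin
      a + d                         ≡⟨ +-comm a d ⟩
      d + a                         ≡⟨ m≡m%n+[m/n]*n (d + a) n ⟩
      (d + a) % n + (d + a) / n * n ≡⟨ cong (_+ (d + a) / n * n) [d+a]%n≡a ⟩
      a + (d + a) / n * n           ∎)

mod-cong : ∀ a b n .{{_ : NonZero n}} → a % n ≡ b % n → a mod n ≡ b mod n
mod-cong _ _ _ eq = fromℕ<-cong _ _ eq _ _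

toℕ-mod : ∀ a n .{{_ : NonZero n}} → toℕ (a mod n) ≡ a % n
toℕ-mod a n = toℕ-fromℕ< _

mod-toℕ : ∀ {n} (i : Fin n) .{{_ : NonZero n}} → toℕ i mod n ≡ i
mod-toℕ {n} i = toℕ-injective (trans (toℕ-mod (toℕ i) n) (m<n⇒m%n≡m (toℕ<n i)))

[k+a-mod]-mod : ∀ k a n .{{_ : NonZero n}} → (k + toℕ (a mod n)) mod n ≡ (k + a) mod n
[k+a-mod]-mod k a n = mod-cong (k + toℕ (a mod n)) (k + a) n
  (trans (cong (λ r → (k + r) % n) (toℕ-mod a n)) ([k+a%n]%n≡[k+a]%n k a n))

[n+a]-mod : ∀ a n .{{_ : NonZero n}} → (n + a) mod n ≡ a mod n
[n+a]-mod a n = mod-cong (n + a) a n (trans (cong (_% n) (+-comm n a)) ([m+n]%n≡m%n a n))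

sucMod-mod : ∀ a → sucMod (a mod suc m) ≡ suc a mod suc m
sucMod-mod {m} a = [k+a-mod]-mod 1 a (suc m)

predMod : Fin (suc m) → Fin (suc m)
predMod {m} i = (m + toℕ i) mod suc m

sucMod-predMod : (i : Fin (suc m)) → sucMod (predMod i) ≡ i
sucMod-predMod {m} i = begin
  sucMod ((m + toℕ i) mod suc m) ≡⟨ sucMod-mod (m + toℕ i) ⟩
  (suc m + toℕ i) mod suc m      ≡⟨ [n+a]-mod (toℕ i) (suc m) ⟩
  toℕ i mod suc m                ≡⟨ mod-toℕ i ⟩
  i                              ∎

predMod-sucMod : (i : Fin (suc m)) → predMod (sucMod i) ≡ i
predMod-sucMod {m} i = begin
  (m + toℕ (suc (toℕ i) mod suc m)) mod suc m ≡⟨ [k+a-mod]-mod m (suc (toℕ i)) (suc m) ⟩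
  (m + suc (toℕ i)) mod suc m                 ≡⟨ cong (_mod suc m) (+-suc m (toℕ i)) ⟩
  (suc m + toℕ i) mod suc m                   ≡⟨ [n+a]-mod (toℕ i) (suc m) ⟩
  toℕ i mod suc m                             ≡⟨ mod-toℕ i ⟩
  i                                           ∎

sucMod-injective : {i j : Fin (suc m)} → sucMod i ≡ sucMod j → i ≡ j
sucMod-injective {i = i} {j} eq = trans (sym (predMod-sucMod i)) (trans (cong predMod eq) (predMod-sucMod j))

[d+i]-mod≢i : ∀ {d n} (i : Fin n) .{{_ : NonZero n}} → d > 0 → d < n → (d + toℕ i) mod n ≢ i
[d+i]-mod≢i {d} {n} i d>0 d<n eq = [d+a]%n≢a n d>0 d<n (trans (sym (toℕ-mod (d + toℕ i) n)) (cong toℕ eq))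

sucMod[i]≢i : 1 < suc m → (i : Fin (suc m)) → sucMod i ≢ i
sucMod[i]≢i 1<n i = [d+i]-mod≢i i (s≤s z≤n) 1<n

sucMod²[i]≢i : 2 < suc m → (i : Fin (suc m)) → sucMod (sucMod i) ≢ i
sucMod²[i]≢i 2<n i = [d+i]-mod≢i i (s≤s z≤n) 2<n ∘ trans (sym (sucMod-mod (suc (toℕ i))))

record InDegreeTwo {W : Set} (_⇒_ : W → W → Set) : Set where
  field
    inˡ inʳ   : W → W
    inˡ-⇒     : ∀ t → inˡ t ⇒ t
    inʳ-⇒     : ∀ t → inʳ t ⇒ t
    inˡ≢inʳ   : ∀ t → inˡ t ≢ inʳ t
    ⇒-inˡ⊎inʳ : ∀ {s t} → s ⇒ t → s ≡ inˡ t ⊎ s ≡ inʳ t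

module InDegreeTwoProperties {W : Set} {_⇒_ : W → W → Set}
  (_≟_ : DecidableEquality W) (D : InDegreeTwo _⇒_) where
  open InDegreeTwo D

  otherIn : W → W → W
  otherIn t s with s ≟ inˡ t
  ... | yes _ = inʳ t
  ... | no  _ = inˡ t

  otherIn-⇒ : ∀ t s → otherIn t s ⇒ t
  otherIn-⇒ t s with s ≟ inˡ t
  ... | yes _ = inʳ-⇒ t
  ... | no  _ = inˡ-⇒ t

  otherIn-≢ : ∀ t s → otherIn t s ≢ s
  otherIn-≢ t s with s ≟ inˡ t
  ... | yes s≡inˡ = λ inʳ≡s → inˡ≢inʳ t (sym (trans inʳ≡s s≡inˡ))
  ... | no  s≢inˡ = s≢inˡ ∘ sym

  ⇒-same⊎otherIn : ∀ {s a t} → s ⇒ t → a ⇒ t → a ≡ s ⊎ a ≡ otherIn t s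
  ⇒-same⊎otherIn {s} {t = t} s⇒t a⇒t with s ≟ inˡ t | ⇒-inˡ⊎inʳ s⇒t | ⇒-inˡ⊎inʳ a⇒t
  ... | yes s≡inˡ | _          | inj₁ a≡inˡ = inj₁ (trans a≡inˡ (sym s≡inˡ))
  ... | yes _     | _          | inj₂ a≡inʳ = inj₂ a≡inʳ
  ... | no  s≢inˡ | inj₁ s≡inˡ | _          = contradiction s≡inˡ s≢inˡ
  ... | no  _     | inj₂ _     | inj₁ a≡inˡ = inj₂ a≡inˡ
  ... | no  _     | inj₂ s≡inʳ | inj₂ a≡inʳ = inj₁ (trans a≡inʳ (sym s≡inʳ))

SameEdge-swapˡ : {V : Set} {a b c d : V} → SameEdge a b c d → SameEdge b a c d
SameEdge-swapˡ (inj₁ (a≡c , b≡d)) = inj₂ (b≡d , a≡c)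
SameEdge-swapˡ (inj₂ (a≡d , b≡c)) = inj₁ (b≡c , a≡d)

SameEdge-swapʳ : {V : Set} {a b c d : V} → SameEdge a b c d → SameEdge a b d c
SameEdge-swapʳ (inj₁ (a≡c , b≡d)) = inj₂ (a≡c , b≡d)
SameEdge-swapʳ (inj₂ (a≡d , b≡c)) = inj₁ (a≡d , b≡c)

module _ {V W : Set} {A : V → V → Set} {B : W → W → Set} {φ : V → W}
  (compatible : Compatible A B φ)
  (arc-injective : ∀ {u w u′ w′} → A u w → A u′ w′ → φ u ≡ φ u′ → φ w ≡ φ w′ → u ≡ u′ × w ≡ w′)
  (arc-surjective : ∀ {a b} → B a b → ∃[ u ] ∃[ w ] (A u w × φ u ≡ a × φ w ≡ b))
  (B-asym : Asymmetric B) where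

  private
    arcs-SameEdge : ∀ {u w u′ w′} → A u w → A u′ w′ →
                    SameEdge (φ u) (φ w) (φ u′) (φ w′) → SameEdge u w u′ w′
    arcs-SameEdge a a′ (inj₁ (φu≡φu′ , φw≡φw′)) = inj₁ (arc-injective a a′ φu≡φu′ φw≡φw′)
    arcs-SameEdge a a′ (inj₂ (φu≡φw′ , φw≡φu′)) = ⊥-elim $
      B-asym (compatible _ _ a) (subst₂ B (sym φw≡φu′) (sym φu≡φw′) (compatible _ _ a′))

  covering-of-arc-bijection : IsCovering (λ u w → A u w ⊎ A w u) (λ a b → B a b ⊎ B b a) φ
  covering-of-arc-bijection = hom , injective , surjective
    where
      hom : IsHom (λ u w → A u w ⊎ A w u) (λ a b → B a b ⊎ B b a) φ
      hom u w (inj₁ a) = inj₁ (compatible u w a)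
      hom u w (inj₂ a) = inj₂ (compatible w u a)

      injective : ∀ u w u′ w′ → A u w ⊎ A w u → A u′ w′ ⊎ A w′ u′ →
                  SameEdge (φ u) (φ w) (φ u′) (φ w′) → SameEdge u w u′ w′
      injective _ _ _ _ (inj₁ a) (inj₁ a′) = arcs-SameEdge a a′
      injective _ _ _ _ (inj₁ a) (inj₂ a′) = SameEdge-swapʳ ∘ arcs-SameEdge a a′ ∘ SameEdge-swapʳ
      injective _ _ _ _ (inj₂ a) (inj₁ a′) = SameEdge-swapˡ ∘ arcs-SameEdge a a′ ∘ SameEdge-swapˡ
      injective _ _ _ _ (inj₂ a) (inj₂ a′) =
        SameEdge-swapˡ ∘ SameEdge-swapʳ ∘ arcs-SameEdge a a′ ∘ SameEdge-swapʳ ∘ SameEdge-swapˡ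

      surjective : ∀ a b → B a b ⊎ B b a → ∃[ u ] ∃[ w ] ((A u w ⊎ A w u) × SameEdge (φ u) (φ w) a b)
      surjective a b (inj₁ arc) with arc-surjective arc
      ... | u , w , a′ , φu≡a , φw≡b = u , w , inj₁ a′ , inj₁ (φu≡a , φw≡b)
      surjective a b (inj₂ arc) with arc-surjective arc
      ... | u , w , a′ , φu≡b , φw≡a = u , w , inj₁ a′ , inj₂ (φu≡b , φw≡a)

module SunletLift
  {W : Set} {_⇒_ : W → W → Set} (_≟_ : DecidableEquality W) (⇒-asym : Asymmetric _⇒_)
  (ins : InDegreeTwo _⇒_) (outs : InDegreeTwo (flip _⇒_))
  {p : ℕ} (h : Fin (suc p) → W) (h-bijective : Bijective _≡_ _≡_ h)
  (h-⇒ : ∀ k → h k ⇒ h (sucMod k)) where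

  open InDegreeTwoProperties _≟_ ins
  open InDegreeTwoProperties _≟_ outs using () renaming
    (otherIn to otherOut; otherIn-⇒ to otherOut-⇒; otherIn-≢ to otherOut-≢; ⇒-same⊎otherIn to ⇒-same⊎otherOut)

  private
    h-injective : Injective _≡_ _≡_ h
    h-injective = proj₁ h-bijective

    position : W → Fin (suc p)
    position t = proj₁ (proj₂ h-bijective t)

    h-position : ∀ t → h (position t) ≡ t
    h-position t = proj₂ (proj₂ h-bijective t) refl

    position-h : ∀ k → position (h k) ≡ k
    position-h k = h-injective (h-position (h k))

    h-predMod-⇒ : ∀ k → h (predMod k) ⇒ h k
    h-predMod-⇒ k = subst (λ j → h (predMod k) ⇒ h j) (sucMod-predMod k) (h-⇒ (predMod k))

  lift : SunletV (suc p) → W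
  lift (inj₁ k) = h k
  lift (inj₂ k) = otherIn (h k) (h (predMod k))

  lift-compatible : Compatible FSMArc _⇒_ lift
  lift-compatible _ _ (cyc k)  = h-⇒ k
  lift-compatible _ _ (pend k) = otherIn-⇒ (h k) (h (predMod k))

  private
    cyc-pend-distinct-images : ∀ k j → lift (inj₁ k) ≡ lift (inj₂ j) → lift (inj₁ (sucMod k)) ≢ lift (inj₁ j)
    cyc-pend-distinct-images k j hk≡ℓj hsk≡hj with h-injective hsk≡hj
    ... | refl = otherIn-≢ (h (sucMod k)) (h (predMod (sucMod k)))
                   (trans (sym hk≡ℓj) (cong h (sym (predMod-sucMod k))))

  lift-arc-injective : ∀ {u w u′ w′} → FSMArc u w → FSMArc u′ w′ →
                       lift u ≡ lift u′ → lift w ≡ lift w′ → u ≡ u′ × w ≡ w′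
  lift-arc-injective (cyc k) (cyc k′) _ e with sucMod-injective (h-injective e)
  ... | refl = refl , refl
  lift-arc-injective (pend k) (pend k′) _ e with h-injective e
  ... | refl = refl , refl
  lift-arc-injective (cyc k) (pend j) e e′ = ⊥-elim (cyc-pend-distinct-images k j e e′)
  lift-arc-injective (pend j) (cyc k) e e′ = ⊥-elim (cyc-pend-distinct-images k j (sym e) (sym e′))

  lift-arc-surjective : ∀ {s t} → s ⇒ t → ∃[ u ] ∃[ w ] (FSMArc u w × lift u ≡ s × lift w ≡ t)
  lift-arc-surjective {s} {t} s⇒t
    with ⇒-same⊎otherIn (h-predMod-⇒ (position t)) (subst (s ⇒_) (sym (h-position t)) s⇒t)
  ... | inj₁ s≡prev = inj₁ (predMod (position t)) , inj₁ (sucMod (predMod (position t))) ,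
                      cyc (predMod (position t)) ,
                      sym s≡prev , trans (cong h (sucMod-predMod (position t))) (h-position t)
  ... | inj₂ s≡other = inj₂ (position t) , inj₁ (position t) , pend (position t) ,
                       sym s≡other , h-position t

  lift-covering : IsCovering SunletAdj (λ a b → a ⇒ b ⊎ b ⇒ a) lift
  lift-covering = covering-of-arc-bijection lift-compatible lift-arc-injective lift-arc-surjective ⇒-asym

  lift-twoToOne : TwoToOne lift
  lift-twoToOne v = inj₁ (position v) , inj₂ j , (λ ()) , h-position v , ℓj↦v , preimages
    where
      next : W
      next = h (sucMod (position v))

      v⇒next : v ⇒ next
      v⇒next = subst (_⇒ next) (h-position v) (h-⇒ (position v))

      j : Fin (suc p)
      j = position (otherOut v next)

      ℓj↦v : lift (inj₂ j) ≡ v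
      ℓj↦v with ⇒-same⊎otherIn (h-predMod-⇒ j)
                 (subst (v ⇒_) (sym (h-position _)) (otherOut-⇒ v next))
      ... | inj₂ v≡other = sym v≡other
      ... | inj₁ v≡prev = ⊥-elim (otherOut-≢ v next (sym (begin
        next                   ≡⟨ cong (h ∘ sucMod) (trans (cong position v≡prev) (position-h _)) ⟩
        h (sucMod (predMod j)) ≡⟨ cong h (sucMod-predMod j) ⟩
        h j                    ≡⟨ h-position _ ⟩
        otherOut v next        ∎)))

      preimages : ∀ u → lift u ≡ v → u ≡ inj₁ (position v) ⊎ u ≡ inj₂ j
      preimages (inj₁ k) hk≡v = inj₁ (cong inj₁ (trans (sym (position-h k)) (cong position hk≡v)))
      preimages (inj₂ k) ℓk≡v
        with ⇒-same⊎otherOut v⇒next (subst (_⇒ h k) ℓk≡v (lift-compatible _ _ (pend k)))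
      ... | inj₂ hk≡other = inj₂ (cong inj₂ (trans (sym (position-h k)) (cong position hk≡other)))
      ... | inj₁ hk≡next = ⊥-elim (otherIn-≢ (h k) (h (predMod k)) (trans ℓk≡v (sym (begin
        h (predMod k)                     ≡⟨ cong (h ∘ predMod) (h-injective hk≡next) ⟩
        h (predMod (sucMod (position v))) ≡⟨ cong h (predMod-sucMod _) ⟩
        h (position v)                    ≡⟨ h-position v ⟩
        v                                 ∎))))

  lift-hamiltonian : IsHamiltonianCycle (λ a b → a ⇒ b ⊎ b ⇒ a) (lift ∘ cycleZ)
  lift-hamiltonian = h-bijective , inj₁ ∘ h-⇒

StdArc-target : ∀ {x y : Fin (suc m)} {t} → StdArc (x , y) t → t ≡ (sucMod x , y) ⊎ t ≡ (x , sucMod y)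
StdArc-target (horiz _ _) = inj₁ refl
StdArc-target (vert _ _)  = inj₂ refl

StdArc-asym : 2 < suc m → Asymmetric (StdArc {suc m})
StdArc-asym 2<n (horiz x y) back with StdArc-target back
... | inj₁ e = sucMod²[i]≢i 2<n x (sym (cong proj₁ e))
... | inj₂ e = sucMod[i]≢i (<-trans (n<1+n 1) 2<n) x (sym (cong proj₁ e))
StdArc-asym 2<n (vert x y) back with StdArc-target back
... | inj₁ e = sucMod[i]≢i (<-trans (n<1+n 1) 2<n) y (sym (cong proj₂ e))
... | inj₂ e = sucMod²[i]≢i 2<n y (sym (cong proj₂ e))

StdArc-inDegreeTwo : 1 < suc m → InDegreeTwo (StdArc {suc m})
StdArc-inDegreeTwo 1<n = record
  { inˡ       = λ (x , y) → predMod x , y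
  ; inʳ       = λ (x , y) → x , predMod y
  ; inˡ-⇒     = λ (x , y) → subst (λ x′ → StdArc (predMod x , y) (x′ , y)) (sucMod-predMod x) (horiz _ _)
  ; inʳ-⇒     = λ (x , y) → subst (λ y′ → StdArc (x , predMod y) (x , y′)) (sucMod-predMod y) (vert _ _)
  ; inˡ≢inʳ   = λ (x , y) e → sucMod[i]≢i 1<n x (trans (sym (cong (sucMod ∘ proj₁) e)) (sucMod-predMod x))
  ; ⇒-inˡ⊎inʳ = λ where
      (horiz x y) → inj₁ (cong (_, y) (sym (predMod-sucMod x)))
      (vert x y)  → inj₂ (cong (x ,_) (sym (predMod-sucMod y)))
  }

StdArc-outDegreeTwo : 1 < suc m → InDegreeTwo (flip (StdArc {suc m}))
StdArc-outDegreeTwo 1<n = record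
  { inˡ       = λ (x , y) → sucMod x , y
  ; inʳ       = λ (x , y) → x , sucMod y
  ; inˡ-⇒     = λ (x , y) → horiz x y
  ; inʳ-⇒     = λ (x , y) → vert x y
  ; inˡ≢inʳ   = λ (x , y) e → sucMod[i]≢i 1<n x (cong proj₁ e)
  ; ⇒-inˡ⊎inʳ = StdArc-target
  }

closed-walk-⇒ : {W : Set} {_⇒_ : W → W → Set} (f : ℕ → W) → (∀ t → f t ⇒ f (suc t)) →
                f (suc m) ≡ f 0 → (k : Fin (suc m)) → f (toℕ k) ⇒ f (toℕ (sucMod k))
closed-walk-⇒ {m} {_⇒_ = _⇒_} f f-⇒ f-closed k = subst (f (toℕ k) ⇒_) f[1+k]≡f[sucMod[k]] (f-⇒ (toℕ k))
  where
    f[1+k]≡f[sucMod[k]] : f (suc (toℕ k)) ≡ f (toℕ (sucMod k))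
    f[1+k]≡f[sucMod[k]] with m≤n⇒m<n∨m≡n (toℕ<n k)
    ... | inj₁ 1+k<n = cong f (sym (trans (toℕ-mod (suc (toℕ k)) (suc m)) (m<n⇒m%n≡m 1+k<n)))
    ... | inj₂ 1+k≡n = begin
      f (suc (toℕ k))         ≡⟨ cong f 1+k≡n ⟩
      f (suc m)               ≡⟨ f-closed ⟩
      f 0                     ≡⟨ cong f (trans (cong (_% suc m) 1+k≡n) (n%n≡0 (suc m))) ⟨
      f (suc (toℕ k) % suc m) ≡⟨ cong f (toℕ-mod (suc (toℕ k)) (suc m)) ⟨
      f (toℕ (sucMod k))      ∎

module TorusHamiltonianDicycle (N : ℕ) where

  private
    n : ℕ
    n = suc N

  -- Row q, column r; since N * q ≡ - q (mod n), this is the vertex (r - q , q).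
  vertexAt : ℕ → ℕ → TorusV n
  vertexAt q r = (r + N * q) mod n , q mod n

  vertexAt-⇒-next-column : ∀ q r → StdArc (vertexAt q r) (vertexAt q (suc r))
  vertexAt-⇒-next-column q r =
    subst (λ x → StdArc (vertexAt q r) (x , q mod n)) (sucMod-mod (r + N * q)) (horiz _ _)

  vertexAt-⇒-next-row : ∀ q → StdArc (vertexAt q N) (vertexAt (suc q) 0)
  vertexAt-⇒-next-row q = subst₂ (λ x y → StdArc (vertexAt q N) (x , y))
    (cong (_mod n) (sym (*-suc N q))) (sucMod-mod q) (vert _ _)

  walk : ℕ → TorusV n
  walk t = vertexAt (t / n) (t % n)

  walk-vertexAt : ∀ q {r} → r < n → walk (r + q * n) ≡ vertexAt q r
  walk-vertexAt q {r} r<n = cong₂ vertexAt quotient remainder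
    where
      r%n≡r : r % n ≡ r
      r%n≡r = m<n⇒m%n≡m r<n

      no-carry : r % n + q * n % n < n
      no-carry = subst (_< n) (sym (trans (cong₂ _+_ r%n≡r (m*n%n≡0 q n)) (+-identityʳ r))) r<n

      quotient : (r + q * n) / n ≡ q
      quotient = begin
        (r + q * n) / n   ≡⟨ +-distrib-/ r (q * n) no-carry ⟩
        r / n + q * n / n ≡⟨ cong₂ _+_ (m<n⇒m/n≡0 r<n) (m*n/n≡m q n) ⟩
        q                 ∎

      remainder : (r + q * n) % n ≡ r
      remainder = trans ([m+kn]%n≡m%n r q n) r%n≡r

  walk-⇒ : ∀ t → StdArc (walk t) (walk (suc t))
  walk-⇒ t with m≤n⇒m<n∨m≡n (m%n<n t n)
  ... | inj₁ 1+r<n = subst (StdArc (walk t)) (sym (begin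
    walk (suc t)                       ≡⟨ cong (walk ∘ suc) (m≡m%n+[m/n]*n t n) ⟩
    walk (suc (t % n) + t / n * n)     ≡⟨ walk-vertexAt (t / n) 1+r<n ⟩
    vertexAt (t / n) (suc (t % n))     ∎)) (vertexAt-⇒-next-column (t / n) (t % n))
  ... | inj₂ 1+r≡n = subst₂ StdArc (cong (vertexAt (t / n)) (sym (suc-injective 1+r≡n))) (sym (begin
    walk (suc t)                       ≡⟨ cong (walk ∘ suc) (m≡m%n+[m/n]*n t n) ⟩
    walk (suc (t % n) + t / n * n)     ≡⟨ cong (λ a → walk (a + t / n * n)) 1+r≡n ⟩
    walk (0 + suc (t / n) * n)         ≡⟨ walk-vertexAt (suc (t / n)) (s≤s z≤n) ⟩
    vertexAt (suc (t / n)) 0           ∎)) (vertexAt-⇒-next-row (t / n))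

  walk-closed : walk (n * n) ≡ walk 0
  walk-closed = trans (walk-vertexAt n (s≤s z≤n)) (cong₂ _,_
    (mod-cong (N * n) (N * 0) n (trans (m*n%n≡0 N n) (cong (_% n) (sym (*-zeroʳ N)))))
    (mod-cong n 0 n (n%n≡0 n)))

  cycle : Fin (n * n) → TorusV n
  cycle k = walk (toℕ k)

  cycle-⇒ : ∀ k → StdArc (cycle k) (cycle (sucMod k))
  cycle-⇒ = closed-walk-⇒ {_⇒_ = StdArc} walk walk-⇒ walk-closed

  position : TorusV n → Fin (n * n)
  position (x , y) = combine y ((toℕ x + toℕ y) mod n)

  cycle-position : ∀ v → cycle (position v) ≡ v
  cycle-position (x , y) = begin
    walk (toℕ (combine y r))         ≡⟨ cong walk (toℕ-combine y r) ⟩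
    walk (n * toℕ y + toℕ r)         ≡⟨ cong walk (+-comm (n * toℕ y) (toℕ r)) ⟩
    walk (toℕ r + n * toℕ y)         ≡⟨ cong (λ a → walk (toℕ r + a)) (*-comm n (toℕ y)) ⟩
    walk (toℕ r + toℕ y * n)         ≡⟨ walk-vertexAt (toℕ y) (toℕ<n r) ⟩
    vertexAt (toℕ y) (toℕ r)         ≡⟨ cong₂ _,_ x-coordinate (mod-toℕ y) ⟩
    (x , y)                          ∎
    where
      r : Fin n
      r = (toℕ x + toℕ y) mod n

      x-coordinate : (toℕ r + N * toℕ y) mod n ≡ x
      x-coordinate = begin
        (toℕ r + N * toℕ y) mod n           ≡⟨ cong (_mod n) (+-comm (toℕ r) _) ⟩
        (N * toℕ y + toℕ r) mod n           ≡⟨ [k+a-mod]-mod (N * toℕ y) (toℕ x + toℕ y) n ⟩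
        (N * toℕ y + (toℕ x + toℕ y)) mod n ≡⟨ cong (_mod n) (+-comm (N * toℕ y) _) ⟩
        (toℕ x + toℕ y + N * toℕ y) mod n   ≡⟨ cong (_mod n) (+-assoc (toℕ x) (toℕ y) _) ⟩
        (toℕ x + n * toℕ y) mod n           ≡⟨ cong (λ a → (toℕ x + a) mod n) (*-comm n (toℕ y)) ⟩
        (toℕ x + toℕ y * n) mod n           ≡⟨ mod-cong (toℕ x + toℕ y * n) (toℕ x) n
                                                 ([m+kn]%n≡m%n (toℕ x) (toℕ y) n) ⟩
        toℕ x mod n                         ≡⟨ mod-toℕ x ⟩
        x                                   ∎

  position-vertexAt : ∀ q r → position (vertexAt q r) ≡ combine (q mod n) (r mod n)
  position-vertexAt q r =
    cong (combine (q mod n)) (mod-cong (toℕ ((r + N * q) mod n) + toℕ (q mod n)) r n (begin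
      (toℕ ((r + N * q) mod n) + toℕ (q mod n)) % n
        ≡⟨ cong₂ (λ a b → (a + b) % n) (toℕ-mod (r + N * q) n) (toℕ-mod q n) ⟩
      ((r + N * q) % n + q % n) % n
        ≡⟨ %-distribˡ-+ (r + N * q) q n ⟨
      (r + N * q + q) % n
        ≡⟨ cong (_% n) (+-assoc r (N * q) q) ⟩
      (r + (N * q + q)) % n
        ≡⟨ cong (λ a → (r + a) % n) (trans (+-comm (N * q) q) (*-comm n q)) ⟩
      (r + q * n) % n
        ≡⟨ [m+kn]%n≡m%n r q n ⟩
      r % n ∎))

  position-cycle : ∀ k → position (cycle k) ≡ k
  position-cycle k = trans (position-vertexAt (t / n) (t % n)) (toℕ-injective (begin
    toℕ (combine ((t / n) mod n) ((t % n) mod n)) ≡⟨ toℕ-combine ((t / n) mod n) _ ⟩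
    n * toℕ ((t / n) mod n) + toℕ ((t % n) mod n) ≡⟨ cong₂ (λ a b → n * a + b) toℕ[q-mod] toℕ[r-mod] ⟩
    n * (t / n) + t % n                           ≡⟨ +-comm (n * (t / n)) (t % n) ⟩
    t % n + n * (t / n)                           ≡⟨ cong (t % n +_) (*-comm n (t / n)) ⟩
    t % n + t / n * n                             ≡⟨ m≡m%n+[m/n]*n t n ⟨
    t                                             ∎))
    where
      t : ℕ
      t = toℕ k

      toℕ[q-mod] : toℕ ((t / n) mod n) ≡ t / n
      toℕ[q-mod] = trans (toℕ-mod (t / n) n) (m<n⇒m%n≡m (m<n*o⇒m/o<n (toℕ<n k)))

      toℕ[r-mod] : toℕ ((t % n) mod n) ≡ t % n
      toℕ[r-mod] = trans (toℕ-mod (t % n) n) (m%n%n≡m%n t n)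

  cycle-bijective : Bijective _≡_ _≡_ cycle
  cycle-bijective = inverseᵇ⇒bijective
    (strictlyInverseˡ⇒inverseˡ {f⁻¹ = position} cycle cycle-position
    , strictlyInverseʳ⇒inverseʳ {f⁻¹ = position} cycle position-cycle)

theorem1 : (n : ℕ) → n ≥ 3 →
    Σ (SunletV (n * n) → TorusV n) (λ φ →
        IsCovering SunletAdj TorusAdj φ
      × TwoToOne φ
      × IsHamiltonianCycle TorusAdj (φ ∘ cycleZ)
      × Compatible FSMArc StdArc φ)
theorem1 (suc N) 2<n = lift , lift-covering , lift-twoToOne , lift-hamiltonian , lift-compatible
  where
    1<n : 1 < suc N
    1<n = <-trans (n<1+n 1) 2<n

    open TorusHamiltonianDicycle N using (cycle; cycle-bijective; cycle-⇒)
    open SunletLift (≡-dec _≟_ _≟_) (StdArc-asym 2<n) (StdArc-inDegreeTwo 1<n) (StdArc-outDegreeTwo 1<n)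
                    cycle cycle-bijective cycle-⇒
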